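{- Let $r=r(n)\geq 3$ and $m=m(n)$ be integers with $1\leq m=O(\log(r^{ -2}n))$. Let $\mathcal{H}^+_r(n,m)$ be the set of $r$-graphs $H\in\mathcal{H}_r(n,m)$ such that: (a) any two edges of $H$ intersect in at most two vertices; (b) every cluster of $H$ is a Type-4 cluster; (c) any two distinct Type-4 clusters of $H$ are vertex-disjoint; (d) $H$ has at most two Type-4 clusters. Then, as $n\to\infty$, \[ \frac{|\mathcal{H}^+_r(n,m)|}{|\mathcal{H}_r(n,m)|}=1-O\Bigl(\frac{r^6m^2}{n^3}\Bigr). \]
   Context: An $r$-graph on $[n]$ is a set of $r$-subsets of $[n]$ (edges); $\mathcal{H}_r(n,m)$ is the set of $r$-graphs on $[n]$ with $m$ edges. Two edges $e,f$ of $H$ are linked if $|e\cap f|=2$. Let $G_H$ be the simple graph whose vertices are the edges of $H$, two being adjacent iff they are linked. A cluster of $H$ is the set of edges of $H$ forming a connected component of $G_H$ with at least two vertices. A Type-4 cluster is a cluster consisting of exactly two edges. -}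

module Defs where

open import Data.Nat using (ℕ; zero; suc; _+_; _*_; _∸_; _^_; _≤_)
open import Data.Bool using (true; false)
open import Data.Vec using ([]; _∷_)
open import Data.List using (List; []; _∷_; map; _++_; filter; length)
open import Data.Fin.Subset using (Subset; _∩_; ∣_∣)
open import Data.List.Membership.Propositional using (_∈_)
open import Data.Product using (_×_; Σ; ∃; _,_)
open import Relation.Binary.PropositionalEquality using (_≡_; _≢_)
open import Relation.Binary.Construct.Closure.ReflexiveTransitive using (Star)
open import Relation.Nullary using (¬_; Dec)
open import Relation.Unary using (Pred; Decidable)
open import Data.Nat.Properties using (_≟_)
open import Data.Sum using (_⊎_)
open import Data.Empty using (⊥)

allSubsets : (n : ℕ) → List (Subset n)
allSubsets zero = [] ∷ []
allSubsets (suc n) = map (true ∷_) (allSubsets n) ++ map (false ∷_) (allSubsets n)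

-- all sublists (sub-multisets respecting order) of a list; for a duplicate-free
-- list this enumerates each subset exactly once
sublists : ∀ {a} {A : Set a} → List A → List (List A)
sublists [] = [] ∷ []
sublists (x ∷ xs) = map (x ∷_) (sublists xs) ++ sublists xs

rSets : (n r : ℕ) → List (Subset n)
rSets n r = filter (λ s → ∣ s ∣ ≟ r) (allSubsets n)

-- An r-graph on [n] is a set of r-subsets of [n], represented as a duplicate-free
-- list of edges. 𝓗 n r m enumerates H_r(n,m), each r-graph exactly once.
RGraph : ℕ → Set
RGraph n = List (Subset n)

𝓗 : (n r m : ℕ) → List (RGraph n)
𝓗 n r m = filter (λ H → length H ≟ m) (sublists (rSets n r))

Linked : ∀ {n} → Subset n → Subset n → Set
Linked e f = ∣ e ∩ f ∣ ≡ 2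

Adj : ∀ {n} → RGraph n → Subset n → Subset n → Set
Adj H e f = e ∈ H × f ∈ H × Linked e f

Reach : ∀ {n} → RGraph n → Subset n → Subset n → Set
Reach H = Star (Adj H)

-- the component of e (e ∈ H) is a cluster: it has at least two edges
IsClusterOf : ∀ {n} → RGraph n → Subset n → Set
IsClusterOf H e = e ∈ H × Σ _ λ f → f ∈ H × f ≢ e × Reach H e f

-- the component of e (e ∈ H) is a Type-4 cluster: it has exactly two edges
IsType4Of : ∀ {n} → RGraph n → Subset n → Set
IsType4Of H e = e ∈ H × Σ _ λ f → f ∈ H × f ≢ e × Reach H e f ×
  (∀ g → g ∈ H → Reach H e g → g ≡ e ⊎ g ≡ f)

Disjoint : ∀ {n} → Subset n → Subset n → Set
Disjoint e f = ∣ e ∩ f ∣ ≡ 0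

Plus : ∀ {n} → RGraph n → Set
Plus H =
  (∀ e f → e ∈ H → f ∈ H → e ≢ f → ∣ e ∩ f ∣ ≤ 2) ×
  (∀ e → IsClusterOf H e → IsType4Of H e) ×
  (∀ e f → IsType4Of H e → IsType4Of H f → ¬ Reach H e f →
     ∀ g h → Reach H e g → Reach H f h → Disjoint g h) ×
  (∀ e f g → IsType4Of H e → IsType4Of H f → IsType4Of H g →
     ¬ Reach H e f → ¬ Reach H e g → ¬ Reach H f g → ⊥)

-- |H^+_r(n,m)|, computed with any decision procedure for Plus
-- (the count does not depend on the choice of decision procedure)
countPlus : (dec : ∀ {n} → Decidable (Plus {n})) → (n r m : ℕ) → ℕ
countPlus dec n r m = length (filter dec (𝓗 n r m))

module Submission where

open import Defs
open import Data.Nat using (ℕ; _*_; _∸_; _^_; _≤_)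
open import Data.List using (length)
open import Data.Product using (Σ)
open import Relation.Unary using (Decidable)

open import Level using (Level)
open import Function using (_∘_)
open import Data.Empty using (⊥; ⊥-elim)
open import Data.Sum using (_⊎_; inj₁; inj₂)
open import Data.Product using (_×_; _,_; proj₁; proj₂)
open import Data.Bool using (true; false)
open import Data.Bool.Properties using () renaming (_≟_ to _≟ᵇ_)
open import Data.Nat
open import Data.Nat.Properties
open import Data.Nat.Combinatorics using (_C_; nC1≡n; k>n⇒nCk≡0; nCk+nC[k+1]≡[n+1]C[k+1])
open import Data.Nat.DivMod using (_/_; _%_; m/n*n≤m; m≡m%n+[m/n]*n; m%n<n)
open import Data.Nat.ListAction using (sum)
open import Data.Nat.Tactic.RingSolver using (solve-∀)
open import Data.Vec using ([]; _∷_)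
open import Data.Vec.Properties using (∷-injectiveʳ; ≡-dec)
open import Data.Fin.Subset using (Subset; _∩_; ∣_∣)
open import Data.Fin.Subset.Properties using (∩-idem; ∩-comm)
open import Data.List using (List; []; _∷_; map; _++_; filter; concatMap)
open import Data.List.Properties using (filter-none; filter-++; filter-≐; filter-all; length-++; length-map)
open import Data.List.Membership.Propositional using (_∈_; lose)
open import Data.List.Membership.Propositional.Properties
  using (∈-++⁻; ∈-map⁺; ∈-map⁻; ∈-filter⁺; ∈-filter⁻; ∈-concat⁺′; ∈-concat⁻′)
import Data.List.Membership.DecPropositional as DecMembership
open import Data.List.Relation.Unary.Any using (Any; here; there; any?)
open import Data.List.Relation.Unary.All as All using (All; []; _∷_; all?)
open import Data.List.Relation.Unary.AllPairs using ([]; _∷_)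
open import Data.List.Relation.Unary.Unique.Propositional using (Unique)
open import Data.List.Relation.Unary.Unique.Propositional.Properties using (++⁺; map⁺; filter⁺)
open import Data.List.Relation.Unary.Unique.DecPropositional using (unique?)
open import Relation.Nullary using (¬_; Dec; yes; no; ¬?; contradiction)
open import Relation.Nullary.Decidable using (_×-dec_; True; toWitness)
open import Relation.Unary using (Pred; _≐_)
open import Relation.Unary.Properties using (∁?; _∪?_; _∩?_)
open import Relation.Binary.Definitions using (DecidableEquality)
open import Relation.Binary.PropositionalEquality using (_≡_; _≢_; refl; sym; trans; cong; cong₂; module ≡-Reasoning)
open import Relation.Binary.Construct.Closure.ReflexiveTransitive using (ε; _◅_; _◅◅_; reverse)
import Algebra.Properties.CommutativeSemigroup as CommSemigroupProperties

-- An r-graph H ∈ 𝓗 n r m lies outside H⁺ only if it contains distinct edges forming one of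
-- four configurations: two edges sharing three vertices; a linked path e, f, g; two linked
-- pairs one of whose edges meets one of the other; three linked pairs. Each is a chain
-- e₀, …, e_k with |e_{i-1} ∩ e_i| ≥ j_i for thresholds 3 / 2,2 / 2,1,2 / 2,0,2,0,2.
-- With N = C(n,r), an edge meets at most C(r,j) C(n-j,r-j) ≤ r^{2j} N / (n-j)^j others in
-- j vertices, and a fixed set of k+1 distinct edges lies in at most C(N-k-1,m-k-1) ≤
-- (2m/N)^{k+1} |𝓗| of the graphs. The union bound over chains thus bounds the number of
-- bad graphs by 2^{k+1} (2r²)^{Σj} m^{k+1} |𝓗| / n^{Σj}, and the hypothesis m = O(log(n/r²))
-- gives r² m² = O(n), which brings every configuration down to O(r⁶ m² / n³) |𝓗|.

^-distribʳ-* : ∀ a b k → (a * b) ^ k ≡ a ^ k * b ^ k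
^-distribʳ-* a b zero    = refl
^-distribʳ-* a b (suc k) = trans (cong (a * b *_) (^-distribʳ-* a b k)) (interchange a b (a ^ k) (b ^ k))
  where
  interchange : ∀ a b x y → a * b * (x * y) ≡ a * x * (b * y)
  interchange = solve-∀

^-square : ∀ a k → (a * a) ^ k ≡ a ^ (2 * k)
^-square a k = trans (^-distribʳ-* a a k) (trans (sym (^-distribˡ-+-* a k k)) (cong (λ i → a ^ (k + i)) (sym (+-identityʳ k))))

^-cancelʳ-≤ : ∀ k .{{_ : NonZero k}} {a b} → a ^ k ≤ b ^ k → a ≤ b
^-cancelʳ-≤ k {a} {b} aᵏ≤bᵏ with a ≤? b
... | yes a≤b = a≤b
... | no  a≰b = contradiction aᵏ≤bᵏ (<⇒≱ (^-monoˡ-< k (≰⇒> a≰b)))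

^≤2^*∸^ : ∀ {n k} → 2 * k ≤ n → n ^ k ≤ 2 ^ k * (n ∸ k) ^ k
^≤2^*∸^ {n} {k} 2k≤n = begin
  n ^ k              ≤⟨ ^-monoˡ-≤ k n≤2[n∸k] ⟩
  (2 * (n ∸ k)) ^ k  ≡⟨ ^-distribʳ-* 2 (n ∸ k) k ⟩
  2 ^ k * (n ∸ k) ^ k ∎
  where
  open ≤-Reasoning
  k≤n∸k : k ≤ n ∸ k
  k≤n∸k = ≤-trans (≤-reflexive (sym (m+n∸n≡m k k))) (∸-monoˡ-≤ k (≤-trans (≤-reflexive (cong (k +_) (sym (+-identityʳ k)))) 2k≤n))
  n≤2[n∸k] : n ≤ 2 * (n ∸ k)
  n≤2[n∸k] = begin
    n                  ≡⟨ sym (m∸n+n≡m (≤-trans (m≤m+n k (k + 0)) 2k≤n)) ⟩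
    (n ∸ k) + k        ≤⟨ +-monoʳ-≤ (n ∸ k) k≤n∸k ⟩
    (n ∸ k) + (n ∸ k)  ≡⟨ cong ((n ∸ k) +_) (sym (+-identityʳ (n ∸ k))) ⟩
    2 * (n ∸ k)        ∎

1+n≤2^n : ∀ n → 1 + n ≤ 2 ^ n
1+n≤2^n zero    = ≤-refl
1+n≤2^n (suc n) = begin
  2 + n           ≤⟨ +-mono-≤ (m^n>0 2 n) (1+n≤2^n n) ⟩
  2 ^ n + 2 ^ n   ≡⟨ cong (2 ^ n +_) (sym (+-identityʳ (2 ^ n))) ⟩
  2 ^ suc n       ∎
  where open ≤-Reasoning

-- With q = m / p we have m < p * 2 ^ q, so m ^ p < p ^ p * 2 ^ (q * p).
^≤^*2^ : ∀ p .{{_ : NonZero p}} m → m ^ p ≤ p ^ p * 2 ^ m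
^≤^*2^ p m = begin
  m ^ p             ≤⟨ ^-monoˡ-≤ p (<⇒≤ m<p*2^q) ⟩
  (p * 2 ^ q) ^ p   ≡⟨ ^-distribʳ-* p (2 ^ q) p ⟩
  p ^ p * (2 ^ q) ^ p ≡⟨ cong (p ^ p *_) (^-*-assoc 2 q p) ⟩
  p ^ p * 2 ^ (q * p) ≤⟨ *-monoʳ-≤ (p ^ p) (^-monoʳ-≤ 2 (m/n*n≤m m p)) ⟩
  p ^ p * 2 ^ m       ∎
  where
  open ≤-Reasoning
  q = m / p
  m<p*2^q : m < p * 2 ^ q
  m<p*2^q = begin-strict
    m                ≡⟨ m≡m%n+[m/n]*n m p ⟩
    m % p + q * p    <⟨ +-monoˡ-< (q * p) (m%n<n m p) ⟩
    p + q * p        ≡⟨ cong (p +_) (*-comm q p) ⟩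
    p + p * q        ≡⟨ sym (*-suc p q) ⟩
    p * suc q        ≤⟨ *-monoʳ-≤ p (1+n≤2^n q) ⟩
    p * 2 ^ q        ∎

-- Each of the a surplus factors n is paid for by x * m ^ 2 ≤ D * n, using m ^ b ≤ (m ^ 2) ^ a.
module Rescale {x m n D : ℕ} .{{_ : NonZero n}} (1≤m : 1 ≤ m) (xm²≤Dn : x * m ^ 2 ≤ D * n) where

  rescale : ∀ {S c M} a b → b ≤ 2 * a →
    S * n ^ (3 + a) ≤ c * x ^ (3 + a) * m ^ (2 + b) * M →
    S * n ^ 3 ≤ c * D ^ a * x ^ 3 * m ^ 2 * M
  rescale {S} {c} {M} a b b≤2a h = *-cancelʳ-≤ _ _ (n ^ a) {{m^n≢0 n a}} (begin
    S * n ^ 3 * n ^ a                            ≡⟨ trans (*-assoc S _ _) (cong (S *_) (sym (^-distribˡ-+-* n 3 a))) ⟩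
    S * n ^ (3 + a)                              ≤⟨ h ⟩
    c * x ^ (3 + a) * m ^ (2 + b) * M            ≡⟨ cong₂ (λ u v → c * u * v * M) (^-distribˡ-+-* x 3 a) (^-distribˡ-+-* m 2 b) ⟩
    c * (x ^ 3 * x ^ a) * (m ^ 2 * m ^ b) * M    ≡⟨ regroup c (x ^ 3) (x ^ a) (m ^ 2) (m ^ b) M ⟩
    c * x ^ 3 * m ^ 2 * M * (x ^ a * m ^ b)      ≤⟨ *-monoʳ-≤ (c * x ^ 3 * m ^ 2 * M) (*-monoʳ-≤ (x ^ a) mᵇ≤[m²]ᵃ) ⟩
    c * x ^ 3 * m ^ 2 * M * (x ^ a * (m ^ 2) ^ a) ≡⟨ cong (c * x ^ 3 * m ^ 2 * M *_) (sym (^-distribʳ-* x (m ^ 2) a)) ⟩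
    c * x ^ 3 * m ^ 2 * M * (x * m ^ 2) ^ a       ≤⟨ *-monoʳ-≤ (c * x ^ 3 * m ^ 2 * M) (^-monoˡ-≤ a xm²≤Dn) ⟩
    c * x ^ 3 * m ^ 2 * M * (D * n) ^ a           ≡⟨ cong (c * x ^ 3 * m ^ 2 * M *_) (^-distribʳ-* D n a) ⟩
    c * x ^ 3 * m ^ 2 * M * (D ^ a * n ^ a)       ≡⟨ regroup′ c (x ^ 3) (m ^ 2) M (D ^ a) (n ^ a) ⟩
    c * D ^ a * x ^ 3 * m ^ 2 * M * n ^ a         ∎)
    where
    open ≤-Reasoning
    instance _ = >-nonZero 1≤m
    mᵇ≤[m²]ᵃ : m ^ b ≤ (m ^ 2) ^ a
    mᵇ≤[m²]ᵃ = ≤-trans (^-monoʳ-≤ m b≤2a) (≤-reflexive (sym (^-*-assoc m 2 a)))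
    regroup : ∀ c x³ xᵃ m² mᵇ M → c * (x³ * xᵃ) * (m² * mᵇ) * M ≡ c * x³ * m² * M * (xᵃ * mᵇ)
    regroup = solve-∀
    regroup′ : ∀ c x³ m² M Dᵃ nᵃ → c * x³ * m² * M * (Dᵃ * nᵃ) ≡ c * Dᵃ * x³ * m² * M * nᵃ
    regroup′ = solve-∀

-- Binomial coefficients

C-suc : ∀ n k → suc n C suc k ≡ n C k + n C suc k
C-suc n k = sym (nCk+nC[k+1]≡[n+1]C[k+1] n k)

C-mono : ∀ n k → n C k ≤ suc n C k
C-mono n zero    = ≤-refl
C-mono n (suc k) = ≤-trans (m≤n+m (n C suc k) (n C k)) (≤-reflexive (sym (C-suc n k)))

C≤^ : ∀ n k → n C k ≤ n ^ k
C≤^ n       zero    = ≤-refl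
C≤^ zero    (suc k) = z≤n
C≤^ (suc n) (suc k) = begin
  suc n C suc k            ≡⟨ C-suc n k ⟩
  n C k + n C suc k        ≤⟨ +-mono-≤ (C≤^ n k) (C≤^ n (suc k)) ⟩
  n ^ k + n * n ^ k        ≤⟨ +-mono-≤ n^k≤ (*-monoʳ-≤ n n^k≤) ⟩
  suc n ^ k + n * suc n ^ k ∎
  where
  open ≤-Reasoning
  n^k≤ : n ^ k ≤ suc n ^ k
  n^k≤ = ^-monoˡ-≤ k (n≤1+n n)

C-pos : ∀ {n k} → k ≤ n → 1 ≤ n C k
C-pos {n}     {zero}  _         = ≤-refl
C-pos {suc n} {suc k} (s≤s k≤n) = ≤-trans (C-pos k≤n) (≤-trans (m≤m+n _ _) (≤-reflexive (sym (C-suc n k))))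

n≤C : ∀ {n k} → 1 ≤ k → k < n → n ≤ n C k
n≤C {suc n} {suc zero}    _ _             = ≤-reflexive (sym (nC1≡n (suc n)))
n≤C {suc n} {suc (suc k)} _ (s≤s k+1<n) = begin
  suc n                        ≤⟨ s≤s (n≤C (s≤s z≤n) k+1<n) ⟩
  1 + n C suc k                ≡⟨ +-comm 1 (n C suc k) ⟩
  n C suc k + 1                ≤⟨ +-monoʳ-≤ (n C suc k) (C-pos k+1<n) ⟩
  n C suc k + n C suc (suc k)  ≡⟨ sym (C-suc n (suc k)) ⟩
  suc n C suc (suc k)          ∎
  where open ≤-Reasoning

C-absorb : ∀ n k → suc k * (suc n C suc k) ≡ suc n * (n C k)
C-absorb zero    zero    = refl
C-absorb zero    (suc k) = begin
  suc (suc k) * (1 C suc (suc k)) ≡⟨ cong (suc (suc k) *_) (k>n⇒nCk≡0 {1} {suc (suc k)} (s≤s (s≤s z≤n))) ⟩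
  suc (suc k) * 0                 ≡⟨ *-zeroʳ (suc (suc k)) ⟩
  0                               ∎
  where open ≡-Reasoning
C-absorb (suc n) zero    = begin
  1 * (suc (suc n) C 1) ≡⟨ *-identityˡ _ ⟩
  suc (suc n) C 1       ≡⟨ nC1≡n (suc (suc n)) ⟩
  suc (suc n)           ≡⟨ sym (*-identityʳ (suc (suc n))) ⟩
  suc (suc n) * 1       ∎
  where open ≡-Reasoning
C-absorb (suc n) (suc k) = begin
  suc (suc k) * (suc (suc n) C suc (suc k))
    ≡⟨ cong (suc (suc k) *_) (C-suc (suc n) (suc k)) ⟩
  suc (suc k) * (suc n C suc k + suc n C suc (suc k))
    ≡⟨ *-distribˡ-+ (suc (suc k)) (suc n C suc k) _ ⟩
  suc n C suc k + suc k * (suc n C suc k) + suc (suc k) * (suc n C suc (suc k))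
    ≡⟨ cong₂ (λ a b → suc n C suc k + a + b) (C-absorb n k) (C-absorb n (suc k)) ⟩
  suc n C suc k + suc n * (n C k) + suc n * (n C suc k)
    ≡⟨ +-assoc (suc n C suc k) _ _ ⟩
  suc n C suc k + (suc n * (n C k) + suc n * (n C suc k))
    ≡⟨ cong (suc n C suc k +_) (sym (*-distribˡ-+ (suc n) (n C k) _)) ⟩
  suc n C suc k + suc n * (n C k + n C suc k)
    ≡⟨ cong (λ x → suc n C suc k + suc n * x) (sym (C-suc n k)) ⟩
  suc (suc n) * (suc n C suc k) ∎
  where open ≡-Reasoning

-- supersets N m k = C(N - k, m - k) if k ≤ m and k ≤ N, and 0 otherwise: the number of
-- m-subsets of an N-set containing a fixed k-subset.
supersets : ℕ → ℕ → ℕ → ℕ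
supersets N       m       zero    = N C m
supersets zero    m       (suc k) = 0
supersets (suc N) zero    (suc k) = 0
supersets (suc N) (suc m) (suc k) = supersets N m k

supersets-mono : ∀ N m k → supersets N m k ≤ supersets (suc N) m k
supersets-mono N       m       zero    = C-mono N m
supersets-mono zero    m       (suc k) = z≤n
supersets-mono (suc N) zero    (suc k) = z≤n
supersets-mono (suc N) (suc m) (suc k) = supersets-mono N m k

supersets-pascal : ∀ N m k → supersets N m k + supersets N (suc m) k ≤ supersets (suc N) (suc m) k
supersets-pascal N       m       zero    = ≤-reflexive (sym (C-suc N m))
supersets-pascal zero    m       (suc k) = z≤n
supersets-pascal (suc N) zero    (suc k) = supersets-mono N zero k
supersets-pascal (suc N) (suc m) (suc k) = supersets-pascal N m k

supersets-suc : ∀ N m k → supersets N (suc m) (suc k) ≤ supersets N m k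
supersets-suc zero    m k = z≤n
supersets-suc (suc N) m k = supersets-mono N m k

supersets-bound : ∀ N m k → supersets N m k * (N ∸ k) ^ k ≤ (N C m) * m ^ k
supersets-bound N       m       zero    = ≤-refl
supersets-bound zero    m       (suc k) = z≤n
supersets-bound (suc N) zero    (suc k) = z≤n
supersets-bound (suc N) (suc m) (suc k) = begin
  supersets N m k * ((N ∸ k) * (N ∸ k) ^ k)  ≡⟨ x∙yz≈y∙xz (supersets N m k) (N ∸ k) _ ⟩
  (N ∸ k) * (supersets N m k * (N ∸ k) ^ k)  ≤⟨ *-mono-≤ (≤-trans (m∸n≤m N k) (n≤1+n N)) (supersets-bound N m k) ⟩
  suc N * ((N C m) * m ^ k)                  ≡⟨ sym (*-assoc (suc N) (N C m) (m ^ k)) ⟩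
  suc N * (N C m) * m ^ k                    ≡⟨ cong (_* m ^ k) (sym (C-absorb N m)) ⟩
  suc m * (suc N C suc m) * m ^ k            ≡⟨ cong (_* m ^ k) (*-comm (suc m) (suc N C suc m)) ⟩
  (suc N C suc m) * suc m * m ^ k            ≡⟨ *-assoc (suc N C suc m) (suc m) (m ^ k) ⟩
  (suc N C suc m) * (suc m * m ^ k)          ≤⟨ *-monoʳ-≤ (suc N C suc m) (*-monoʳ-≤ (suc m) (^-monoˡ-≤ k (n≤1+n m))) ⟩
  (suc N C suc m) * (suc m * suc m ^ k)      ∎
  where
  open ≤-Reasoning
  open CommSemigroupProperties *-commutativeSemigroup using (x∙yz≈y∙xz)

supersets-bound′ : ∀ {N m k} → 2 * k ≤ N → supersets N m k * N ^ k ≤ 2 ^ k * ((N C m) * m ^ k)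
supersets-bound′ {N} {m} {k} 2k≤N = begin
  supersets N m k * N ^ k                    ≤⟨ *-monoʳ-≤ (supersets N m k) (^≤2^*∸^ {N} {k} 2k≤N) ⟩
  supersets N m k * (2 ^ k * (N ∸ k) ^ k)    ≡⟨ x∙yz≈y∙xz (supersets N m k) (2 ^ k) _ ⟩
  2 ^ k * (supersets N m k * (N ∸ k) ^ k)    ≤⟨ *-monoʳ-≤ (2 ^ k) (supersets-bound N m k) ⟩
  2 ^ k * ((N C m) * m ^ k)                  ∎
  where
  open ≤-Reasoning
  open CommSemigroupProperties *-commutativeSemigroup using (x∙yz≈y∙xz)

private variable
  a ℓ ℓ′ : Level
  A B : Set a

count : {P : Pred A ℓ} → Decidable P → List A → ℕ
count P? xs = length (filter P? xs)

module _ {P : Pred A ℓ} (P? : Decidable P) where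

  count-none : ∀ xs → (∀ {x} → x ∈ xs → ¬ P x) → count P? xs ≡ 0
  count-none _ ∉P = cong length (filter-none P? (All.tabulate ∉P))

  count-++ : ∀ xs ys → count P? (xs ++ ys) ≡ count P? xs + count P? ys
  count-++ xs ys = trans (cong length (filter-++ P? xs ys)) (length-++ (filter P? xs))

  count-map : (f : B → A) → ∀ xs → count P? (map f xs) ≡ count (P? ∘ f) xs
  count-map f []       = refl
  count-map f (x ∷ xs) with P? (f x)
  ... | yes _ = cong suc (count-map f xs)
  ... | no  _ = count-map f xs

  count-∁ : ∀ xs → count P? xs + count (∁? P?) xs ≡ length xs
  count-∁ []       = refl
  count-∁ (x ∷ xs) with P? x
  ... | yes _ = cong suc (count-∁ xs)
  ... | no  _ = trans (+-suc _ _) (cong suc (count-∁ xs))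

module _ {P : Pred A ℓ} {Q : Pred A ℓ′} (P? : Decidable P) (Q? : Decidable Q) where

  count-mono : ∀ xs → (∀ {x} → x ∈ xs → P x → Q x) → count P? xs ≤ count Q? xs
  count-mono []       P⇒Q = z≤n
  count-mono (x ∷ xs) P⇒Q with P? x | Q? x
  ... | yes px | yes _  = s≤s (count-mono xs (P⇒Q ∘ there))
  ... | yes px | no ¬qx = ⊥-elim (¬qx (P⇒Q (here refl) px))
  ... | no  _  | yes _  = m≤n⇒m≤1+n (count-mono xs (P⇒Q ∘ there))
  ... | no  _  | no  _  = count-mono xs (P⇒Q ∘ there)

  count-≐ : P ≐ Q → ∀ xs → count P? xs ≡ count Q? xs
  count-≐ P≐Q xs = cong length (filter-≐ P? Q? P≐Q xs)

  count-∪ : ∀ xs → count (P? ∪? Q?) xs ≤ count P? xs + count Q? xs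
  count-∪ []       = z≤n
  count-∪ (x ∷ xs) with P? x | Q? x
  ... | yes _ | yes _ = s≤s (≤-trans (count-∪ xs) (+-monoʳ-≤ (count P? xs) (n≤1+n _)))
  ... | yes _ | no  _ = s≤s (count-∪ xs)
  ... | no  _ | yes _ = ≤-trans (s≤s (count-∪ xs)) (≤-reflexive (sym (+-suc _ _)))
  ... | no  _ | no  _ = count-∪ xs

  count-filter : ∀ xs → count Q? (filter P? xs) ≡ count (P? ∩? Q?) xs
  count-filter []       = refl
  count-filter (x ∷ xs) with P? x
  ... | no  _ = count-filter xs
  ... | yes _ with Q? x
  ...   | yes _ = cong suc (count-filter xs)
  ...   | no  _ = count-filter xs

count-any : {Q : A → Pred B ℓ′} (Q? : ∀ x → Decidable (Q x)) (xs : List A) (ys : List B) {c : ℕ} →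
  (∀ {x} → x ∈ xs → count (Q? x) ys ≤ c) → count (λ y → any? (λ x → Q? x y) xs) ys ≤ length xs * c
count-any Q? []       ys _     = ≤-reflexive (count-none (λ y → any? (λ x → Q? x y) []) ys (λ _ ()))
count-any Q? (x ∷ xs) ys {c} bound = begin
  count (λ y → any? (λ x → Q? x y) (x ∷ xs)) ys
    ≤⟨ count-mono (λ y → any? (λ x → Q? x y) (x ∷ xs)) (Q? x ∪? (λ y → any? (λ x → Q? x y) xs)) ys
         (λ { _ (here q) → inj₁ q ; _ (there qs) → inj₂ qs }) ⟩
  count (Q? x ∪? (λ y → any? (λ x → Q? x y) xs)) ys
    ≤⟨ count-∪ (Q? x) _ ys ⟩
  count (Q? x) ys + count (λ y → any? (λ x → Q? x y) xs) ys
    ≤⟨ +-mono-≤ (bound (here refl)) (count-any Q? xs ys (bound ∘ there)) ⟩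
  c + length xs * c ∎
  where open ≤-Reasoning

length-concatMap-≤ : (f : A → List B) (xs : List A) {d c : ℕ} →
  (∀ {x} → x ∈ xs → length (f x) * d ≤ c) → length (concatMap f xs) * d ≤ length xs * c
length-concatMap-≤ f []       _ = z≤n
length-concatMap-≤ f (x ∷ xs) {d} {c} bound = begin
  length (f x ++ concatMap f xs) * d                 ≡⟨ cong (_* d) (length-++ (f x)) ⟩
  (length (f x) + length (concatMap f xs)) * d       ≡⟨ *-distribʳ-+ d (length (f x)) _ ⟩
  length (f x) * d + length (concatMap f xs) * d     ≤⟨ +-mono-≤ (bound (here refl)) (length-concatMap-≤ f xs (bound ∘ there)) ⟩
  c + length xs * c                                  ∎
  where open ≤-Reasoning

-- Subsets of a finite set

count-allSubsets-suc : ∀ n {P : Pred (Subset (suc n)) ℓ} (P? : Decidable P) →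
  count P? (allSubsets (suc n)) ≡ count (P? ∘ (true ∷_)) (allSubsets n) + count (P? ∘ (false ∷_)) (allSubsets n)
count-allSubsets-suc n P? = trans (count-++ P? (map (true ∷_) (allSubsets n)) _)
  (cong₂ _+_ (count-map P? (true ∷_) (allSubsets n)) (count-map P? (false ∷_) (allSubsets n)))

length-rSets : ∀ n r → length (rSets n r) ≡ n C r
length-rSets zero    zero    = refl
length-rSets zero    (suc r) = refl
length-rSets (suc n) r       = trans (count-allSubsets-suc n (λ s → ∣ s ∣ ≟ r)) (split r)
  where
  𝒮 = allSubsets n
  split : ∀ r → count (λ s → ∣ true ∷ s ∣ ≟ r) 𝒮 + count (λ s → ∣ false ∷ s ∣ ≟ r) 𝒮 ≡ suc n C r
  split zero    = trans (cong (_+ count (λ s → ∣ s ∣ ≟ 0) 𝒮) (count-none (λ s → ∣ true ∷ s ∣ ≟ 0) 𝒮 (λ _ ())))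
                        (length-rSets n zero)
  split (suc r) = begin
    count (λ s → ∣ true ∷ s ∣ ≟ suc r) 𝒮 + count (λ s → ∣ s ∣ ≟ suc r) 𝒮
      ≡⟨ cong (_+ count (λ s → ∣ s ∣ ≟ suc r) 𝒮) (count-≐ _ (λ s → ∣ s ∣ ≟ r) (suc-injective , cong suc) 𝒮) ⟩
    count (λ s → ∣ s ∣ ≟ r) 𝒮 + count (λ s → ∣ s ∣ ≟ suc r) 𝒮
      ≡⟨ cong₂ _+_ (length-rSets n r) (length-rSets n (suc r)) ⟩
    n C r + n C suc r
      ≡⟨ sym (C-suc n r) ⟩
    suc n C suc r ∎
    where open ≡-Reasoning

meets? : ∀ {n} (e : Subset n) (r j : ℕ) → Decidable (λ f → ∣ f ∣ ≡ r × j ≤ ∣ e ∩ f ∣)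
meets? e r j = (λ f → ∣ f ∣ ≟ r) ∩? (λ f → j ≤? ∣ e ∩ f ∣)

C-size-mono : ∀ {n} b (e : Subset n) j → ∣ e ∣ C j ≤ ∣ b ∷ e ∣ C j
C-size-mono true  e j = C-mono ∣ e ∣ j
C-size-mono false e j = ≤-refl

module _ {n} (e : Subset n) (ih : ∀ r j → count (meets? e r j) (allSubsets n) ≤ (∣ e ∣ C j) * supersets n r j) where
  private 𝒮 = allSubsets n

  count-meeting-pascal : ∀ {c} r j → c ≡ count (meets? e r j) 𝒮 →
    c + count (meets? e (suc r) j) 𝒮 ≤ (∣ e ∣ C j) * supersets (suc n) (suc r) j
  count-meeting-pascal r j refl = begin
    count (meets? e r j) 𝒮 + count (meets? e (suc r) j) 𝒮
      ≤⟨ +-mono-≤ (ih r j) (ih (suc r) j) ⟩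
    (∣ e ∣ C j) * supersets n r j + (∣ e ∣ C j) * supersets n (suc r) j
      ≡⟨ sym (*-distribˡ-+ (∣ e ∣ C j) _ _) ⟩
    (∣ e ∣ C j) * (supersets n r j + supersets n (suc r) j)
      ≤⟨ *-monoʳ-≤ (∣ e ∣ C j) (supersets-pascal n r j) ⟩
    (∣ e ∣ C j) * supersets (suc n) (suc r) j ∎
    where open ≤-Reasoning

  count-meeting-∷ : ∀ b r j → count (meets? (b ∷ e) r j ∘ (true ∷_)) 𝒮 + count (meets? e r j) 𝒮
                              ≤ (∣ b ∷ e ∣ C j) * supersets (suc n) r j
  count-meeting-∷ b zero j = begin
    count (meets? (b ∷ e) 0 j ∘ (true ∷_)) 𝒮 + count (meets? e 0 j) 𝒮
      ≡⟨ cong (_+ count (meets? e 0 j) 𝒮) (count-none (meets? (b ∷ e) 0 j ∘ (true ∷_)) 𝒮 (λ _ ())) ⟩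
    count (meets? e 0 j) 𝒮
      ≤⟨ ih 0 j ⟩
    (∣ e ∣ C j) * supersets n 0 j
      ≤⟨ *-mono-≤ (C-size-mono b e j) (supersets-mono n 0 j) ⟩
    (∣ b ∷ e ∣ C j) * supersets (suc n) 0 j ∎
    where open ≤-Reasoning
  count-meeting-∷ false (suc r) j = count-meeting-pascal r j
    (count-≐ _ (meets? e r j) ((λ (p , q) → suc-injective p , q) , (λ (p , q) → cong suc p , q)) 𝒮)
  count-meeting-∷ true (suc r) zero = count-meeting-pascal r 0
    (count-≐ _ (meets? e r 0) ((λ (p , _) → suc-injective p , z≤n) , (λ (p , _) → cong suc p , z≤n)) 𝒮)
  count-meeting-∷ true (suc r) (suc j) = begin
    count (meets? (true ∷ e) (suc r) (suc j) ∘ (true ∷_)) 𝒮 + count (meets? e (suc r) (suc j)) 𝒮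
      ≡⟨ cong (_+ count (meets? e (suc r) (suc j)) 𝒮)
           (count-≐ _ (meets? e r j) ((λ (p , q) → suc-injective p , s≤s⁻¹ q) , (λ (p , q) → cong suc p , s≤s q)) 𝒮) ⟩
    count (meets? e r j) 𝒮 + count (meets? e (suc r) (suc j)) 𝒮
      ≤⟨ +-mono-≤ (ih r j) (ih (suc r) (suc j)) ⟩
    (∣ e ∣ C j) * supersets n r j + (∣ e ∣ C suc j) * supersets n (suc r) (suc j)
      ≤⟨ +-monoʳ-≤ ((∣ e ∣ C j) * supersets n r j) (*-monoʳ-≤ (∣ e ∣ C suc j) (supersets-suc n r j)) ⟩
    (∣ e ∣ C j) * supersets n r j + (∣ e ∣ C suc j) * supersets n r j
      ≡⟨ sym (*-distribʳ-+ (supersets n r j) (∣ e ∣ C j) _) ⟩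
    (∣ e ∣ C j + ∣ e ∣ C suc j) * supersets n r j
      ≡⟨ cong (_* supersets n r j) (sym (C-suc ∣ e ∣ j)) ⟩
    (suc ∣ e ∣ C suc j) * supersets n r j ∎
    where open ≤-Reasoning

count-meeting : ∀ {n} (e : Subset n) r j → count (meets? e r j) (allSubsets n) ≤ (∣ e ∣ C j) * supersets n r j
count-meeting []      zero    zero    = ≤-refl
count-meeting []      (suc r) j       = z≤n
count-meeting []      zero    (suc j) = ≤-reflexive (count-none (meets? [] 0 (suc j)) ([] ∷ []) λ { (here refl) (_ , ()) })
count-meeting {suc n} (b ∷ e) r j     = begin
  count (meets? (b ∷ e) r j) (allSubsets (suc n))
    ≡⟨ count-allSubsets-suc n (meets? (b ∷ e) r j) ⟩
  count (meets? (b ∷ e) r j ∘ (true ∷_)) 𝒮 + count (meets? (b ∷ e) r j ∘ (false ∷_)) 𝒮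
    ≡⟨ cong (count (meets? (b ∷ e) r j ∘ (true ∷_)) 𝒮 +_) (false-part b) ⟩
  count (meets? (b ∷ e) r j ∘ (true ∷_)) 𝒮 + count (meets? e r j) 𝒮
    ≤⟨ count-meeting-∷ e (count-meeting e) b r j ⟩
  (∣ b ∷ e ∣ C j) * supersets (suc n) r j ∎
  where
  open ≤-Reasoning
  𝒮 = allSubsets n
  false-part : ∀ b → count (meets? (b ∷ e) r j ∘ (false ∷_)) 𝒮 ≡ count (meets? e r j) 𝒮
  false-part true  = refl
  false-part false = refl

allSubsets-unique : ∀ n → Unique (allSubsets n)
allSubsets-unique zero    = [] ∷ []
allSubsets-unique (suc n) = ++⁺ (map⁺ ∷-injectiveʳ (allSubsets-unique n)) (map⁺ ∷-injectiveʳ (allSubsets-unique n)) disjoint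
  where
  disjoint : ∀ {s} → ¬ (s ∈ map (true ∷_) (allSubsets n) × s ∈ map (false ∷_) (allSubsets n))
  disjoint (s∈₁ , s∈₂) with ∈-map⁻ (true ∷_) s∈₁ | ∈-map⁻ (false ∷_) s∈₂
  ... | _ , _ , refl | _ , _ , ()

module _ {X : Set} where

  count-sublists-∷ : ∀ {P : Pred (List X) ℓ} (P? : Decidable P) x U →
    count P? (sublists (x ∷ U)) ≡ count (P? ∘ (x ∷_)) (sublists U) + count P? (sublists U)
  count-sublists-∷ P? x U = trans (count-++ P? (map (x ∷_) (sublists U)) (sublists U))
    (cong (_+ count P? (sublists U)) (count-map P? (x ∷_) (sublists U)))

  sublists-⊆ : ∀ (U : List X) {H} → H ∈ sublists U → ∀ {y} → y ∈ H → y ∈ U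
  sublists-⊆ []      (here refl) ()
  sublists-⊆ (x ∷ U) H∈ y∈H with ∈-++⁻ (map (x ∷_) (sublists U)) H∈
  ... | inj₂ H∈′ = there (sublists-⊆ U H∈′ y∈H)
  ... | inj₁ H∈′ with ∈-map⁻ (x ∷_) H∈′ | y∈H
  ...   | _ , H′∈ , refl | here y≡x  = here y≡x
  ...   | _ , H′∈ , refl | there y∈H′ = there (sublists-⊆ U H′∈ y∈H′)

  hasLength? : (m : ℕ) → Decidable (λ (H : List X) → length H ≡ m)
  hasLength? m H = length H ≟ m

  count-sublists-length : ∀ U m → count (hasLength? m) (sublists U) ≡ length U C m
  count-sublists-length []      zero    = refl
  count-sublists-length []      (suc m) = refl
  count-sublists-length (x ∷ U) m       = trans (count-sublists-∷ (hasLength? m) x U) (split m)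
    where
    split : ∀ m → count (hasLength? m ∘ (x ∷_)) (sublists U) + count (hasLength? m) (sublists U) ≡ suc (length U) C m
    split zero    = trans (cong (_+ count (hasLength? 0) (sublists U)) (count-none (hasLength? 0 ∘ (x ∷_)) (sublists U) (λ _ ())))
                          (count-sublists-length U 0)
    split (suc m) = begin
      count (hasLength? (suc m) ∘ (x ∷_)) (sublists U) + count (hasLength? (suc m)) (sublists U)
        ≡⟨ cong (_+ count (hasLength? (suc m)) (sublists U)) (count-≐ _ (hasLength? m) (suc-injective , cong suc) (sublists U)) ⟩
      count (hasLength? m) (sublists U) + count (hasLength? (suc m)) (sublists U)
        ≡⟨ cong₂ _+_ (count-sublists-length U m) (count-sublists-length U (suc m)) ⟩
      length U C m + length U C suc m
        ≡⟨ sym (C-suc (length U) m) ⟩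
      suc (length U) C suc m ∎
      where open ≡-Reasoning

module _ {X : Set} (_≟ₓ_ : DecidableEquality X) where
  open DecMembership _≟ₓ_ using (_∈?_)

  contains? : (t : List X) → Decidable (λ H → All (_∈ H) t)
  contains? t H = all? (_∈? H) t

  remove : X → List X → List X
  remove x = filter (λ y → ¬? (y ≟ₓ x))

  length-remove : ∀ {x t} → Unique t → x ∈ t → suc (length (remove x t)) ≡ length t
  length-remove {x} {y ∷ t} (y∉t ∷ _) (here refl) with y ≟ₓ y
  ... | no  y≢y = ⊥-elim (y≢y refl)
  ... | yes _   = cong (suc ∘ length) (filter-all (λ z → ¬? (z ≟ₓ y)) (All.map (λ y≢z z≡y → y≢z (sym z≡y)) y∉t))
  length-remove {x} {y ∷ t} (y∉t ∷ ut) (there x∈t) with y ≟ₓ x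
  ... | yes refl = ⊥-elim (All.lookup y∉t x∈t refl)
  ... | no  _    = cong suc (length-remove ut x∈t)

  ∈-remove⁻ : ∀ {x y t} → y ∈ remove x t → y ∈ t × y ≢ x
  ∈-remove⁻ {x} {t = t} = ∈-filter⁻ (λ y → ¬? (y ≟ₓ x)) {xs = t}

  superset? : (m : ℕ) (t : List X) → Decidable (λ H → length H ≡ m × All (_∈ H) t)
  superset? m t = hasLength? m ∩? contains? t

  drop-head : ∀ {x y} {H : List X} → y ∈ x ∷ H → y ≢ x → y ∈ H
  drop-head (here y≡x) y≢x = ⊥-elim (y≢x y≡x)
  drop-head (there y∈H) _  = y∈H

  module _ {x U} (x∉U : All (x ≢_) U)
    (ih : ∀ t m → Unique t → count (superset? m t) (sublists U) ≤ supersets (length U) m (length t)) where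
    private 𝒮 = sublists U

    count-superset-∋x : ∀ {t} → x ∈ t → ∀ m → count (superset? m t) 𝒮 ≡ 0
    count-superset-∋x x∈t m = count-none (superset? m _) 𝒮 λ H∈ (_ , t⊆H) →
      All.lookup x∉U (sublists-⊆ U H∈ (All.lookup t⊆H x∈t)) refl

    count-sublists-⊇-∷ : ∀ {t} → Unique t → Dec (x ∈ t) → ∀ m →
      count (superset? m t ∘ (x ∷_)) 𝒮 + count (superset? m t) 𝒮 ≤ supersets (suc (length U)) m (length t)
    count-sublists-⊇-∷ {t} ut (yes x∈t) zero =
      ≤-trans (≤-reflexive (cong₂ _+_ (count-none (superset? 0 t ∘ (x ∷_)) 𝒮 (λ { _ (() , _) })) (count-superset-∋x x∈t 0))) z≤n
    count-sublists-⊇-∷ {t} ut (yes x∈t) (suc m) = begin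
      count (superset? (suc m) t ∘ (x ∷_)) 𝒮 + count (superset? (suc m) t) 𝒮
        ≡⟨ cong (count (superset? (suc m) t ∘ (x ∷_)) 𝒮 +_) (count-superset-∋x x∈t (suc m)) ⟩
      count (superset? (suc m) t ∘ (x ∷_)) 𝒮 + 0
        ≡⟨ +-identityʳ _ ⟩
      count (superset? (suc m) t ∘ (x ∷_)) 𝒮
        ≤⟨ count-mono (superset? (suc m) t ∘ (x ∷_)) (superset? m (remove x t)) 𝒮 (λ _ (len , t⊆x∷H) →
             suc-injective len , All.tabulate λ y∈t′ → let y∈t , y≢x = ∈-remove⁻ y∈t′ in drop-head (All.lookup t⊆x∷H y∈t) y≢x) ⟩
      count (superset? m (remove x t)) 𝒮
        ≤⟨ ih (remove x t) m (filter⁺ _ ut) ⟩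
      supersets (length U) m (length (remove x t))
        ≡⟨ cong (supersets (suc (length U)) (suc m)) (length-remove ut x∈t) ⟩
      supersets (suc (length U)) (suc m) (length t) ∎
      where open ≤-Reasoning
    count-sublists-⊇-∷ {t} ut (no x∉t) zero = begin
      count (superset? 0 t ∘ (x ∷_)) 𝒮 + count (superset? 0 t) 𝒮
        ≡⟨ cong (_+ count (superset? 0 t) 𝒮) (count-none (superset? 0 t ∘ (x ∷_)) 𝒮 (λ { _ (() , _) })) ⟩
      count (superset? 0 t) 𝒮
        ≤⟨ ih t 0 ut ⟩
      supersets (length U) 0 (length t)
        ≤⟨ supersets-mono (length U) 0 (length t) ⟩
      supersets (suc (length U)) 0 (length t) ∎
      where open ≤-Reasoning
    count-sublists-⊇-∷ {t} ut (no x∉t) (suc m) = begin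
      count (superset? (suc m) t ∘ (x ∷_)) 𝒮 + count (superset? (suc m) t) 𝒮
        ≤⟨ +-monoˡ-≤ (count (superset? (suc m) t) 𝒮) (count-mono (superset? (suc m) t ∘ (x ∷_)) (superset? m t) 𝒮
             (λ _ (len , t⊆x∷H) → suc-injective len , All.tabulate λ y∈t → drop-head (All.lookup t⊆x∷H y∈t) λ { refl → x∉t y∈t })) ⟩
      count (superset? m t) 𝒮 + count (superset? (suc m) t) 𝒮
        ≤⟨ +-mono-≤ (ih t m ut) (ih t (suc m) ut) ⟩
      supersets (length U) m (length t) + supersets (length U) (suc m) (length t)
        ≤⟨ supersets-pascal (length U) m (length t) ⟩
      supersets (suc (length U)) (suc m) (length t) ∎
      where open ≤-Reasoning

  count-sublists-⊇ : ∀ U t m → Unique U → Unique t →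
    count (superset? m t) (sublists U) ≤ supersets (length U) m (length t)
  count-sublists-⊇ []      []      zero    _ _ = ≤-refl
  count-sublists-⊇ []      []      (suc m) _ _ = z≤n
  count-sublists-⊇ []      (y ∷ t) m       _ _ =
    ≤-reflexive (count-none (superset? m (y ∷ t)) ([] ∷ []) λ { (here refl) (_ , (() ∷ _)) })
  count-sublists-⊇ (x ∷ U) t m (x∉U ∷ uU) ut = begin
    count (superset? m t) (sublists (x ∷ U))
      ≡⟨ count-sublists-∷ (superset? m t) x U ⟩
    count (superset? m t ∘ (x ∷_)) (sublists U) + count (superset? m t) (sublists U)
      ≤⟨ count-sublists-⊇-∷ x∉U (λ t m → count-sublists-⊇ U t m uU) ut (x ∈? t) m ⟩
    supersets (suc (length U)) m (length t) ∎
    where open ≤-Reasoning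

-- Edges, neighbourhoods and chains

_≟ₛ_ : ∀ {n} → DecidableEquality (Subset n)
_≟ₛ_ = ≡-dec _≟ᵇ_

rSets-unique : ∀ n r → Unique (rSets n r)
rSets-unique n r = filter⁺ (λ s → ∣ s ∣ ≟ r) (allSubsets-unique n)

∈-rSets⁻ : ∀ {n r e} → e ∈ rSets n r → ∣ e ∣ ≡ r
∈-rSets⁻ {n} {r} = proj₂ ∘ ∈-filter⁻ (λ s → ∣ s ∣ ≟ r) {xs = allSubsets n}

∈-𝓗⁻ : ∀ {n r m H e} → H ∈ 𝓗 n r m → e ∈ H → e ∈ rSets n r
∈-𝓗⁻ {n} {r} {m} H∈ = sublists-⊆ (rSets n r) (proj₁ (∈-filter⁻ (hasLength? m) {xs = sublists (rSets n r)} H∈))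

length-𝓗 : ∀ n r m → length (𝓗 n r m) ≡ (n C r) C m
length-𝓗 n r m = trans (count-sublists-length (rSets n r) m) (cong (_C m) (length-rSets n r))

count-𝓗-⊇ : ∀ n r m {t} → Unique t →
  count (contains? _≟ₛ_ t) (𝓗 n r m) ≤ supersets (n C r) m (length t)
count-𝓗-⊇ n r m {t} ut = begin
  count (contains? _≟ₛ_ t) (𝓗 n r m)
    ≡⟨ count-filter (hasLength? m) (contains? _≟ₛ_ t) (sublists (rSets n r)) ⟩
  count (superset? _≟ₛ_ m t) (sublists (rSets n r))
    ≤⟨ count-sublists-⊇ _≟ₛ_ (rSets n r) t m (rSets-unique n r) ut ⟩
  supersets (length (rSets n r)) m (length t)
    ≡⟨ cong (λ N → supersets N m (length t)) (length-rSets n r) ⟩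
  supersets (n C r) m (length t) ∎
  where open ≤-Reasoning

neighbours : ∀ {n} (r j : ℕ) → Subset n → List (Subset n)
neighbours {n} r j e = filter (λ f → j ≤? ∣ e ∩ f ∣) (rSets n r)

length-neighbours : ∀ {n r j e} → e ∈ rSets n r → 2 * j ≤ n →
  length (neighbours r j e) * n ^ j ≤ (2 * (r * r)) ^ j * (n C r)
length-neighbours {n} {r} {j} {e} e∈ 2j≤n = begin
  length (neighbours r j e) * n ^ j
    ≤⟨ *-monoʳ-≤ (length (neighbours r j e)) (^≤2^*∸^ {n} {j} 2j≤n) ⟩
  length (neighbours r j e) * (2 ^ j * (n ∸ j) ^ j)
    ≡⟨ cong (λ c → c * (2 ^ j * (n ∸ j) ^ j)) (count-filter (λ s → ∣ s ∣ ≟ r) (λ f → j ≤? ∣ e ∩ f ∣) (allSubsets n)) ⟩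
  count (meets? e r j) (allSubsets n) * (2 ^ j * (n ∸ j) ^ j)
    ≤⟨ *-monoˡ-≤ _ (count-meeting e r j) ⟩
  (∣ e ∣ C j) * supersets n r j * (2 ^ j * (n ∸ j) ^ j)
    ≡⟨ cong (λ s → (s C j) * supersets n r j * (2 ^ j * (n ∸ j) ^ j)) (∈-rSets⁻ e∈) ⟩
  (r C j) * supersets n r j * (2 ^ j * (n ∸ j) ^ j)
    ≡⟨ regroup (r C j) (supersets n r j) (2 ^ j) ((n ∸ j) ^ j) ⟩
  2 ^ j * ((r C j) * (supersets n r j * (n ∸ j) ^ j))
    ≤⟨ *-monoʳ-≤ (2 ^ j) (*-mono-≤ (C≤^ r j) (supersets-bound n r j)) ⟩
  2 ^ j * (r ^ j * ((n C r) * r ^ j))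
    ≡⟨ regroup′ (2 ^ j) (r ^ j) (n C r) ⟩
  2 ^ j * (r ^ j * r ^ j) * (n C r)
    ≡⟨ cong (λ p → 2 ^ j * p * (n C r)) (sym (^-distribʳ-* r r j)) ⟩
  2 ^ j * (r * r) ^ j * (n C r)
    ≡⟨ cong (_* (n C r)) (sym (^-distribʳ-* 2 (r * r) j)) ⟩
  (2 * (r * r)) ^ j * (n C r) ∎
  where
  open ≤-Reasoning
  regroup : ∀ c s p q → c * s * (p * q) ≡ p * (c * (s * q))
  regroup = solve-∀
  regroup′ : ∀ p a N → p * (a * (N * a)) ≡ p * (a * a) * N
  regroup′ = solve-∀

-- Threshold 0 imposes no condition, so chains with thresholds 2 ∷ 0 ∷ 2 ∷ 0 ∷ 2 ∷ [] are
-- arbitrary triples of linked pairs.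
chainsFrom : ∀ {n} (r : ℕ) → List ℕ → Subset n → List (List (Subset n))
chainsFrom r []       e = (e ∷ []) ∷ []
chainsFrom r (j ∷ js) e = map (e ∷_) (concatMap (chainsFrom r js) (neighbours r j e))

chains : ∀ {n} (r : ℕ) → List ℕ → List (List (Subset n))
chains {n} r js = concatMap (chainsFrom r js) (rSets n r)

length-chainsFrom : ∀ {n r} js {e} → e ∈ rSets n r → All (λ j → 2 * j ≤ n) js →
  length (chainsFrom r js e) * n ^ sum js ≤ (2 * (r * r)) ^ sum js * (n C r) ^ length js
length-chainsFrom         []       _  _               = ≤-refl
length-chainsFrom {n} {r} (j ∷ js) {e} e∈ (2j≤n ∷ 2js≤n) = begin
  length (chainsFrom r (j ∷ js) e) * n ^ (j + d)
    ≡⟨ cong₂ _*_ (length-map (e ∷_) (concatMap (chainsFrom r js) (neighbours r j e))) (^-distribˡ-+-* n j d) ⟩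
  length (concatMap (chainsFrom r js) (neighbours r j e)) * (n ^ j * n ^ d)
    ≡⟨ regroup (length (concatMap (chainsFrom r js) (neighbours r j e))) (n ^ j) (n ^ d) ⟩
  length (concatMap (chainsFrom r js) (neighbours r j e)) * n ^ d * n ^ j
    ≤⟨ *-monoˡ-≤ (n ^ j) (length-concatMap-≤ (chainsFrom r js) (neighbours r j e)
         λ f∈ → length-chainsFrom js (proj₁ (∈-filter⁻ (λ f → j ≤? ∣ e ∩ f ∣) {xs = rSets n r} f∈)) 2js≤n) ⟩
  length (neighbours r j e) * (x ^ d * N ^ length js) * n ^ j
    ≡⟨ swap (length (neighbours r j e)) (x ^ d * N ^ length js) (n ^ j) ⟩
  length (neighbours r j e) * n ^ j * (x ^ d * N ^ length js)
    ≤⟨ *-monoˡ-≤ (x ^ d * N ^ length js) (length-neighbours e∈ 2j≤n) ⟩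
  x ^ j * N * (x ^ d * N ^ length js)
    ≡⟨ regroup′ (x ^ j) N (x ^ d) (N ^ length js) ⟩
  x ^ j * x ^ d * (N * N ^ length js)
    ≡⟨ cong (_* (N * N ^ length js)) (sym (^-distribˡ-+-* x j d)) ⟩
  x ^ (j + d) * N ^ length (j ∷ js) ∎
  where
  open ≤-Reasoning
  d = sum js
  x = 2 * (r * r)
  N = n C r
  regroup : ∀ a b c → a * (b * c) ≡ a * c * b
  regroup = solve-∀
  swap : ∀ a b c → a * b * c ≡ a * c * b
  swap = solve-∀
  regroup′ : ∀ a N b c → a * N * (b * c) ≡ a * b * (N * c)
  regroup′ = solve-∀

length-chains : ∀ {n r} js → All (λ j → 2 * j ≤ n) js →
  length (chains {n} r js) * n ^ sum js ≤ (2 * (r * r)) ^ sum js * (n C r) ^ suc (length js)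
length-chains {n} {r} js 2js≤n = begin
  length (chains {n} r js) * n ^ sum js
    ≤⟨ length-concatMap-≤ (chainsFrom r js) (rSets n r) (λ e∈ → length-chainsFrom js e∈ 2js≤n) ⟩
  length (rSets n r) * ((2 * (r * r)) ^ sum js * (n C r) ^ length js)
    ≡⟨ cong (_* ((2 * (r * r)) ^ sum js * (n C r) ^ length js)) (length-rSets n r) ⟩
  (n C r) * ((2 * (r * r)) ^ sum js * (n C r) ^ length js)
    ≡⟨ x∙yz≈y∙xz (n C r) ((2 * (r * r)) ^ sum js) _ ⟩
  (2 * (r * r)) ^ sum js * (n C r) ^ suc (length js) ∎
  where
  open ≤-Reasoning
  open CommSemigroupProperties *-commutativeSemigroup using (x∙yz≈y∙xz)

HasChain : ∀ {n} (r : ℕ) → List ℕ → RGraph n → Set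
HasChain r js H = Any (λ t → Unique t × All (_∈ H) t) (chains r js)

hasChain? : ∀ {n} r js → Decidable (HasChain {n} r js)
hasChain? r js H = any? (λ t → unique? _≟ₛ_ t ×-dec contains? _≟ₛ_ t H) (chains r js)

∈-chainsFrom-length : ∀ {n r} js {e} {t : List (Subset n)} → t ∈ chainsFrom r js e → length t ≡ suc (length js)
∈-chainsFrom-length         []       (here refl) = refl
∈-chainsFrom-length {r = r} (j ∷ js) {e} t∈ with ∈-map⁻ (e ∷_) t∈
... | t′ , t′∈ , refl with ∈-concat⁻′ (map (chainsFrom r js) (neighbours r j e)) t′∈
...   | _ , t′∈ts , ts∈ with ∈-map⁻ (chainsFrom r js) ts∈
...     | _ , _ , refl = cong suc (∈-chainsFrom-length js t′∈ts)

∈-chains-length : ∀ {n r} js {t : List (Subset n)} → t ∈ chains r js → length t ≡ suc (length js)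
∈-chains-length {n} {r} js t∈ with ∈-concat⁻′ (map (chainsFrom r js) (rSets n r)) t∈
... | _ , t∈ts , ts∈ with ∈-map⁻ (chainsFrom r js) ts∈
...   | _ , _ , refl = ∈-chainsFrom-length js t∈ts

count-hasChain : ∀ n r m js →
  count (hasChain? r js) (𝓗 n r m) ≤ length (chains {n} r js) * supersets (n C r) m (suc (length js))
count-hasChain n r m js = count-any (λ t H → unique? _≟ₛ_ t ×-dec contains? _≟ₛ_ t H) (chains r js) (𝓗 n r m) bound
  where
  bound : ∀ {t} → t ∈ chains r js →
    count (λ H → unique? _≟ₛ_ t ×-dec contains? _≟ₛ_ t H) (𝓗 n r m) ≤ supersets (n C r) m (suc (length js))
  bound {t} t∈ with unique? _≟ₛ_ t
  ... | no ¬u = ≤-trans (≤-reflexive (count-none _ (𝓗 n r m) (λ _ (u , _) → ¬u u))) z≤n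
  ... | yes u = begin
    count (λ H → yes u ×-dec contains? _≟ₛ_ t H) (𝓗 n r m)
      ≤⟨ count-mono _ (contains? _≟ₛ_ t) (𝓗 n r m) (λ _ → proj₂) ⟩
    count (contains? _≟ₛ_ t) (𝓗 n r m)
      ≤⟨ count-𝓗-⊇ n r m u ⟩
    supersets (n C r) m (length t)
      ≡⟨ cong (supersets (n C r) m) (∈-chains-length js t∈) ⟩
    supersets (n C r) m (suc (length js)) ∎
    where open ≤-Reasoning

count-hasChain-bound : ∀ n r m js → 2 * suc (length js) ≤ n C r → All (λ j → 2 * j ≤ n) js →
  count (hasChain? r js) (𝓗 n r m) * n ^ sum js
    ≤ 2 ^ suc (length js) * (2 * (r * r)) ^ sum js * m ^ suc (length js) * length (𝓗 n r m)
count-hasChain-bound n r m js 2k≤N 2js≤n = *-cancelʳ-≤ _ _ (N ^ k) {{m^n≢0 N k}} (begin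
  count (hasChain? r js) (𝓗 n r m) * n ^ d * N ^ k
    ≤⟨ *-monoˡ-≤ (N ^ k) (*-monoˡ-≤ (n ^ d) (count-hasChain n r m js)) ⟩
  length (chains {n} r js) * supersets N m k * n ^ d * N ^ k
    ≡⟨ regroup (length (chains {n} r js)) (supersets N m k) (n ^ d) (N ^ k) ⟩
  length (chains {n} r js) * n ^ d * (supersets N m k * N ^ k)
    ≤⟨ *-mono-≤ (length-chains {n} {r} js 2js≤n) (supersets-bound′ {N} {m} {k} 2k≤N) ⟩
  x ^ d * N ^ k * (2 ^ k * ((N C m) * m ^ k))
    ≡⟨ regroup′ (x ^ d) (N ^ k) (2 ^ k) (N C m) (m ^ k) ⟩
  2 ^ k * x ^ d * m ^ k * (N C m) * N ^ k
    ≡⟨ cong (λ M → 2 ^ k * x ^ d * m ^ k * M * N ^ k) (sym (length-𝓗 n r m)) ⟩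
  2 ^ k * x ^ d * m ^ k * length (𝓗 n r m) * N ^ k ∎)
  where
  open ≤-Reasoning
  N = n C r
  k = suc (length js)
  d = sum js
  x = 2 * (r * r)
  instance _ = >-nonZero (≤-trans (s≤s z≤n) 2k≤N)
  regroup : ∀ l K a b → l * K * a * b ≡ l * a * (K * b)
  regroup = solve-∀
  regroup′ : ∀ a b c M e → a * b * (c * (M * e)) ≡ c * a * e * M * b
  regroup′ = solve-∀

-- Forbidden chains

data Chain {n} (H : RGraph n) : List ℕ → List (Subset n) → Set where
  [_]    : ∀ {e} → e ∈ H → Chain H [] (e ∷ [])
  _∷⟨_⟩_ : ∀ {e f j js t} → e ∈ H → j ≤ ∣ e ∩ f ∣ → Chain H js (f ∷ t) → Chain H (j ∷ js) (e ∷ f ∷ t)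

module _ {n r} {H : RGraph n} (H⊆ : ∀ {e} → e ∈ H → e ∈ rSets n r) where

  Chain-head : ∀ {js e t} → Chain H js (e ∷ t) → e ∈ H
  Chain-head [ e∈ ]        = e∈
  Chain-head (e∈ ∷⟨ _ ⟩ _) = e∈

  Chain-⊆ : ∀ {js t} → Chain H js t → All (_∈ H) t
  Chain-⊆ [ e∈ ]        = e∈ ∷ []
  Chain-⊆ (e∈ ∷⟨ _ ⟩ c) = e∈ ∷ Chain-⊆ c

  Chain-∈chainsFrom : ∀ {js e t} → Chain H js (e ∷ t) → e ∷ t ∈ chainsFrom r js e
  Chain-∈chainsFrom [ _ ] = here refl
  Chain-∈chainsFrom {j ∷ js} {e} (_ ∷⟨ e∩f ⟩ c) = ∈-map⁺ (e ∷_) (∈-concat⁺′ (Chain-∈chainsFrom c)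
    (∈-map⁺ (chainsFrom r js) (∈-filter⁺ (λ f → j ≤? ∣ e ∩ f ∣) (H⊆ (Chain-head c)) e∩f)))

  Chain⇒HasChain : ∀ {js e t} → Chain H js (e ∷ t) → Unique (e ∷ t) → HasChain r js H
  Chain⇒HasChain {js} c u =
    lose (∈-concat⁺′ (Chain-∈chainsFrom c) (∈-map⁺ (chainsFrom r js) (H⊆ (Chain-head c)))) (u , Chain-⊆ c)

module _ {n r} (r≥3 : 3 ≤ r) {H : RGraph n} (H⊆ : ∀ {e} → e ∈ H → e ∈ rSets n r) where

  NoChain : List ℕ → Set
  NoChain js = ∀ {e t} → Chain H js (e ∷ t) → Unique (e ∷ t) → ⊥

  Linked-irrefl : ∀ {e} → e ∈ H → ¬ Linked e e
  Linked-irrefl {e} e∈ e∩e≡2 = <⇒≢ r≥3 (trans (sym e∩e≡2) (trans (cong ∣_∣ (∩-idem e)) (∈-rSets⁻ (H⊆ e∈))))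

  Adj⇒≢ : ∀ {e f} → Adj H e f → e ≢ f
  Adj⇒≢ (e∈ , _ , e∩f≡2) refl = Linked-irrefl e∈ e∩f≡2

  Adj-sym : ∀ {e f} → Adj H e f → Adj H f e
  Adj-sym {e} {f} (e∈ , f∈ , e∩f≡2) = f∈ , e∈ , trans (cong ∣_∣ (∩-comm f e)) e∩f≡2

  Adj⇒2≤ : ∀ {e f} → Adj H e f → 2 ≤ ∣ e ∩ f ∣
  Adj⇒2≤ (_ , _ , e∩f≡2) = ≤-reflexive (sym e∩f≡2)

  Reach-sym : ∀ {e f} → Reach H e f → Reach H f e
  Reach-sym = reverse Adj-sym

  Reach-∈ : ∀ {e f} → e ∈ H → Reach H e f → f ∈ H
  Reach-∈ e∈ ε                 = e∈
  Reach-∈ _  ((_ , f∈ , _) ◅ rest) = Reach-∈ f∈ rest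

  Reach-≢ : ∀ {a b x y} → Reach H a x → Reach H b y → ¬ Reach H a b → x ≢ y
  Reach-≢ ax by ¬ab refl = ¬ab (ax ◅◅ Reach-sym by)

  module _ (no₂ : NoChain (2 ∷ 2 ∷ [])) where

    no-fork : ∀ {a b c} → Adj H b a → Adj H b c → a ≢ c → ⊥
    no-fork ba bc a≢c = no₂ (a∈ ∷⟨ Adj⇒2≤ ab ⟩ (b∈ ∷⟨ Adj⇒2≤ bc ⟩ [ c∈ ]))
      ((Adj⇒≢ ab ∷ a≢c ∷ []) ∷ (Adj⇒≢ bc ∷ []) ∷ [] ∷ [])
      where
      ab = Adj-sym ba
      a∈ = proj₁ ab
      b∈ = proj₁ bc
      c∈ = proj₁ (proj₂ bc)

    pair-closed : ∀ {e f x y} → Adj H e f → Adj H x y → x ≡ e ⊎ x ≡ f → y ≡ e ⊎ y ≡ f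
    pair-closed {e} {f} {y = y} ef ey (inj₁ refl) with y ≟ₛ f
    ... | yes y≡f = inj₂ y≡f
    ... | no  y≢f = ⊥-elim (no-fork ef ey (y≢f ∘ sym))
    pair-closed {e} {f} {y = y} ef fy (inj₂ refl) with y ≟ₛ e
    ... | yes y≡e = inj₁ y≡e
    ... | no  y≢e = ⊥-elim (no-fork (Adj-sym ef) fy (y≢e ∘ sym))

    component-pair : ∀ {e f x g} → Adj H e f → Reach H x g → x ≡ e ⊎ x ≡ f → g ≡ e ⊎ g ≡ f
    component-pair ef ε          x∈ef = x∈ef
    component-pair ef (xy ◅ rest) x∈ef = component-pair ef rest (pair-closed ef xy x∈ef)

    cluster⇒type4 : ∀ e → IsClusterOf H e → IsType4Of H e
    cluster⇒type4 e (e∈ , f , f∈ , f≢e , ε)       = ⊥-elim (f≢e refl)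
    cluster⇒type4 e (e∈ , f , f∈ , f≢e , ey ◅ _) =
      e∈ , _ , proj₁ (proj₂ ey) , Adj⇒≢ ey ∘ sym , ey ◅ ε , λ g _ eg → component-pair ey eg (inj₁ refl)

  type4-partner : ∀ {e} → IsType4Of H e → Σ _ λ e′ → Adj H e e′ × (∀ {g} → Reach H e g → g ≡ e ⊎ g ≡ e′)
  type4-partner (e∈ , f , f∈ , f≢e , ε , closed) = ⊥-elim (f≢e refl)
  type4-partner (e∈ , f , f∈ , f≢e , ey ◅ _ , closed) with closed _ (proj₁ (proj₂ ey)) (ey ◅ ε)
  ... | inj₁ refl = ⊥-elim (Adj⇒≢ ey refl)
  ... | inj₂ refl = _ , ey , λ eg → closed _ (Reach-∈ e∈ eg) eg

  type4-adjacent : ∀ {e g} → IsType4Of H e → Reach H e g → Σ _ λ g′ → Adj H g g′ × Reach H e g′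
  type4-adjacent t4 eg with type4-partner t4
  ... | e′ , ee′ , closed with closed eg
  ...   | inj₁ refl = e′ , ee′ , ee′ ◅ ε
  ...   | inj₂ refl = _ , Adj-sym ee′ , ε

  edges-meet-≤2 : NoChain (3 ∷ []) → ∀ e f → e ∈ H → f ∈ H → e ≢ f → ∣ e ∩ f ∣ ≤ 2
  edges-meet-≤2 no₁ e f e∈ f∈ e≢f with ∣ e ∩ f ∣ ≤? 2
  ... | yes ≤2 = ≤2
  ... | no  ≰2 = ⊥-elim (no₁ (e∈ ∷⟨ ≰⇒> ≰2 ⟩ [ f∈ ]) ((e≢f ∷ []) ∷ [] ∷ []))

  type4-disjoint : NoChain (2 ∷ 1 ∷ 2 ∷ []) → ∀ e f → IsType4Of H e → IsType4Of H f → ¬ Reach H e f →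
    ∀ g h → Reach H e g → Reach H f h → Disjoint g h
  type4-disjoint no₃ e f t4e t4f ¬ef g h eg fh with ∣ g ∩ h ∣ ≟ 0
  ... | yes g∩h≡0 = g∩h≡0
  ... | no  g∩h≢0 with type4-adjacent t4e eg | type4-adjacent t4f fh
  ...   | g′ , gg′ , eg′ | h′ , hh′ , fh′ = ⊥-elim (
    no₃ (g′∈ ∷⟨ Adj⇒2≤ (Adj-sym gg′) ⟩ (g∈ ∷⟨ n≢0⇒n>0 g∩h≢0 ⟩ (h∈ ∷⟨ Adj⇒2≤ hh′ ⟩ [ h′∈ ])))
      ((Adj⇒≢ gg′ ∘ sym ∷ Reach-≢ eg′ fh ¬ef ∷ Reach-≢ eg′ fh′ ¬ef ∷ []) ∷
       (Reach-≢ eg fh ¬ef ∷ Reach-≢ eg fh′ ¬ef ∷ []) ∷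
       (Adj⇒≢ hh′ ∷ []) ∷ [] ∷ []))
    where
    g∈  = Reach-∈ (proj₁ t4e) eg
    g′∈ = Reach-∈ (proj₁ t4e) eg′
    h∈  = Reach-∈ (proj₁ t4f) fh
    h′∈ = Reach-∈ (proj₁ t4f) fh′

  type4-at-most-two : NoChain (2 ∷ 0 ∷ 2 ∷ 0 ∷ 2 ∷ []) → ∀ e f g →
    IsType4Of H e → IsType4Of H f → IsType4Of H g → ¬ Reach H e f → ¬ Reach H e g → ¬ Reach H f g → ⊥
  type4-at-most-two no₄ e f g t4e t4f t4g ¬ef ¬eg ¬fg
    with type4-partner t4e | type4-partner t4f | type4-partner t4g
  ... | e′ , ee′ , _ | f′ , ff′ , _ | g′ , gg′ , _ =
    no₄ (proj₁ t4e ∷⟨ Adj⇒2≤ ee′ ⟩ (proj₁ (proj₂ ee′) ∷⟨ z≤n ⟩ (proj₁ t4f ∷⟨ Adj⇒2≤ ff′ ⟩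
          (proj₁ (proj₂ ff′) ∷⟨ z≤n ⟩ (proj₁ t4g ∷⟨ Adj⇒2≤ gg′ ⟩ [ proj₁ (proj₂ gg′) ])))))
      ((Adj⇒≢ ee′ ∷ Reach-≢ ε ε ¬ef ∷ Reach-≢ ε f⇝f′ ¬ef ∷ Reach-≢ ε ε ¬eg ∷ Reach-≢ ε g⇝g′ ¬eg ∷ []) ∷
       (Reach-≢ e⇝e′ ε ¬ef ∷ Reach-≢ e⇝e′ f⇝f′ ¬ef ∷ Reach-≢ e⇝e′ ε ¬eg ∷ Reach-≢ e⇝e′ g⇝g′ ¬eg ∷ []) ∷
       (Adj⇒≢ ff′ ∷ Reach-≢ ε ε ¬fg ∷ Reach-≢ ε g⇝g′ ¬fg ∷ []) ∷
       (Reach-≢ f⇝f′ ε ¬fg ∷ Reach-≢ f⇝f′ g⇝g′ ¬fg ∷ []) ∷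
       (Adj⇒≢ gg′ ∷ []) ∷ [] ∷ [])
    where
    e⇝e′ = ee′ ◅ ε
    f⇝f′ = ff′ ◅ ε
    g⇝g′ = gg′ ◅ ε

  noChains⇒Plus : NoChain (3 ∷ []) → NoChain (2 ∷ 2 ∷ []) → NoChain (2 ∷ 1 ∷ 2 ∷ []) →
    NoChain (2 ∷ 0 ∷ 2 ∷ 0 ∷ 2 ∷ []) → Plus H
  noChains⇒Plus no₁ no₂ no₃ no₄ =
    edges-meet-≤2 no₁ , cluster⇒type4 no₂ , type4-disjoint no₃ , type4-at-most-two no₄

¬Plus⇒HasChain : ∀ {n r m H} → 3 ≤ r → H ∈ 𝓗 n r m → ¬ Plus H →
  HasChain r (3 ∷ []) H ⊎ HasChain r (2 ∷ 2 ∷ []) H ⊎ HasChain r (2 ∷ 1 ∷ 2 ∷ []) H ⊎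
  HasChain r (2 ∷ 0 ∷ 2 ∷ 0 ∷ 2 ∷ []) H
¬Plus⇒HasChain {n} {r} {H = H} r≥3 H∈ ¬plus
  with hasChain? r (3 ∷ []) H | hasChain? r (2 ∷ 2 ∷ []) H | hasChain? r (2 ∷ 1 ∷ 2 ∷ []) H
     | hasChain? r (2 ∷ 0 ∷ 2 ∷ 0 ∷ 2 ∷ []) H
... | yes c  | _      | _      | _      = inj₁ c
... | no _   | yes c  | _      | _      = inj₂ (inj₁ c)
... | no _   | no _   | yes c  | _      = inj₂ (inj₂ (inj₁ c))
... | no _   | no _   | no _   | yes c  = inj₂ (inj₂ (inj₂ c))
... | no ¬c₁ | no ¬c₂ | no ¬c₃ | no ¬c₄ =
  ⊥-elim (¬plus (noChains⇒Plus r≥3 H⊆ (noChain ¬c₁) (noChain ¬c₂) (noChain ¬c₃) (noChain ¬c₄)))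
  where
  H⊆ : ∀ {e} → e ∈ H → e ∈ rSets n r
  H⊆ = ∈-𝓗⁻ H∈
  noChain : ∀ {js} → ¬ HasChain r js H → NoChain r≥3 H⊆ js
  noChain ¬c c u = ¬c (Chain⇒HasChain H⊆ c u)

-- The estimate

count-¬Plus : ∀ (dec : ∀ {n} → Decidable (Plus {n})) n r m → 3 ≤ r →
  length (𝓗 n r m) ∸ countPlus dec n r m
    ≤ count (hasChain? r (3 ∷ [])) (𝓗 n r m) + (count (hasChain? r (2 ∷ 2 ∷ [])) (𝓗 n r m) +
      (count (hasChain? r (2 ∷ 1 ∷ 2 ∷ [])) (𝓗 n r m) + count (hasChain? r (2 ∷ 0 ∷ 2 ∷ 0 ∷ 2 ∷ [])) (𝓗 n r m)))
count-¬Plus dec n r m r≥3 = begin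
  length Hs ∸ count dec Hs
    ≡⟨ cong (_∸ count dec Hs) (sym (count-∁ dec Hs)) ⟩
  count dec Hs + count (∁? dec) Hs ∸ count dec Hs
    ≡⟨ m+n∸m≡n (count dec Hs) _ ⟩
  count (∁? dec) Hs
    ≤⟨ count-mono (∁? dec) (h₁ ∪? (h₂ ∪? (h₃ ∪? h₄))) Hs (¬Plus⇒HasChain r≥3) ⟩
  count (h₁ ∪? (h₂ ∪? (h₃ ∪? h₄))) Hs
    ≤⟨ count-∪ h₁ _ Hs ⟩
  count h₁ Hs + count (h₂ ∪? (h₃ ∪? h₄)) Hs
    ≤⟨ +-monoʳ-≤ (count h₁ Hs) (count-∪ h₂ _ Hs) ⟩
  count h₁ Hs + (count h₂ Hs + count (h₃ ∪? h₄) Hs)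
    ≤⟨ +-monoʳ-≤ (count h₁ Hs) (+-monoʳ-≤ (count h₂ Hs) (count-∪ h₃ h₄ Hs)) ⟩
  count h₁ Hs + (count h₂ Hs + (count h₃ Hs + count h₄ Hs)) ∎
  where
  open ≤-Reasoning
  Hs = 𝓗 n r m
  h₁ = hasChain? r (3 ∷ [])
  h₂ = hasChain? r (2 ∷ 2 ∷ [])
  h₃ = hasChain? r (2 ∷ 1 ∷ 2 ∷ [])
  h₄ = hasChain? r (2 ∷ 0 ∷ 2 ∷ 0 ∷ 2 ∷ [])

module _ {n r m κ : ℕ} .{{_ : NonZero κ}} (growth : 2 ^ m * r ^ (2 * κ) ≤ n ^ κ) where

  r²≤n : r * r ≤ n
  r²≤n = ^-cancelʳ-≤ κ (begin
    (r * r) ^ κ            ≡⟨ ^-square r κ ⟩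
    r ^ (2 * κ)            ≤⟨ m≤n*m (r ^ (2 * κ)) (2 ^ m) {{m^n≢0 2 m}} ⟩
    2 ^ m * r ^ (2 * κ)    ≤⟨ growth ⟩
    n ^ κ                  ∎)
    where open ≤-Reasoning

  n≤nCr : 3 ≤ r → n ≤ n C r
  n≤nCr r≥3 = n≤C (≤-trans (s≤s z≤n) r≥3) (<-≤-trans (m<m*n r r {{>-nonZero (≤-trans (s≤s z≤n) r≥3)}} (≤-trans (s≤s (s≤s z≤n)) r≥3)) r²≤n)

  -- The growth hypothesis absorbs m ^ (2κ) through m ^ (2κ) ≤ (2κ) ^ (2κ) * 2 ^ m.
  r²m²≤n : 2 * (r * r) * m ^ 2 ≤ 2 * ((2 * κ) * (2 * κ)) * n
  r²m²≤n = ^-cancelʳ-≤ κ (begin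
    (2 * (r * r) * m ^ 2) ^ κ
      ≡⟨ trans (^-distribʳ-* (2 * (r * r)) (m ^ 2) κ) (cong (_* (m ^ 2) ^ κ) (^-distribʳ-* 2 (r * r) κ)) ⟩
    2 ^ κ * (r * r) ^ κ * (m ^ 2) ^ κ
      ≡⟨ cong₂ (λ a b → 2 ^ κ * a * b) (^-square r κ) (^-*-assoc m 2 κ) ⟩
    2 ^ κ * r ^ (2 * κ) * m ^ (2 * κ)
      ≤⟨ *-monoʳ-≤ (2 ^ κ * r ^ (2 * κ)) (^≤^*2^ p {{m*n≢0 2 κ}} m) ⟩
    2 ^ κ * r ^ (2 * κ) * (p ^ (2 * κ) * 2 ^ m)
      ≡⟨ regroup (2 ^ κ) (r ^ (2 * κ)) (p ^ (2 * κ)) (2 ^ m) ⟩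
    2 ^ κ * p ^ (2 * κ) * (2 ^ m * r ^ (2 * κ))
      ≤⟨ *-monoʳ-≤ (2 ^ κ * p ^ (2 * κ)) growth ⟩
    2 ^ κ * p ^ (2 * κ) * n ^ κ
      ≡⟨ cong (λ a → 2 ^ κ * a * n ^ κ) (sym (^-square p κ)) ⟩
    2 ^ κ * (p * p) ^ κ * n ^ κ
      ≡⟨ trans (cong (_* n ^ κ) (sym (^-distribʳ-* 2 (p * p) κ))) (sym (^-distribʳ-* (2 * (p * p)) n κ)) ⟩
    (2 * (p * p) * n) ^ κ ∎)
    where
    open ≤-Reasoning
    p = 2 * κ
    regroup : ∀ a b c d → a * b * (c * d) ≡ a * c * (d * b)
    regroup = solve-∀

count-short-chain-bound : ∀ n r m → 12 ≤ n → n ≤ n C r →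
  ∀ js → {True (all? (λ j → 2 * j ≤? 12) js)} → {True (2 * suc (length js) ≤? 12)} →
  count (hasChain? r js) (𝓗 n r m) * n ^ sum js
    ≤ 2 ^ suc (length js) * (2 * (r * r)) ^ sum js * m ^ suc (length js) * length (𝓗 n r m)
count-short-chain-bound n r m n≥12 n≤N js {short} {few} =
  count-hasChain-bound n r m js (≤-trans (toWitness few) (≤-trans n≥12 n≤N))
    (All.map (λ 2j≤12 → ≤-trans 2j≤12 n≥12) (toWitness short))

constant : ℕ → ℕ
constant κ = 8 * (4 + 8 * D + 16 * D ^ 2 + 64 * D ^ 3)
  where D = 2 * ((2 * κ) * (2 * κ))

main-bound : ∀ (dec : ∀ {n} → Decidable (Plus {n})) n r m κ .{{_ : NonZero κ}} →
  3 ≤ r → 1 ≤ m → 12 ≤ n → 2 ^ m * r ^ (2 * κ) ≤ n ^ κ →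
  (length (𝓗 n r m) ∸ countPlus dec n r m) * n ^ 3 ≤ constant κ * (r ^ 6 * m ^ 2) * length (𝓗 n r m)
main-bound dec n r m κ r≥3 m≥1 n≥12 growth = begin
  (length (𝓗 n r m) ∸ countPlus dec n r m) * n ^ 3
    ≤⟨ *-monoˡ-≤ (n ^ 3) (count-¬Plus dec n r m r≥3) ⟩
  (S₁ + (S₂ + (S₃ + S₄))) * n ^ 3
    ≡⟨ distrib S₁ S₂ S₃ S₄ (n ^ 3) ⟩
  S₁ * n ^ 3 + (S₂ * n ^ 3 + (S₃ * n ^ 3 + S₄ * n ^ 3))
    ≤⟨ +-mono-≤ bound₁ (+-mono-≤ bound₂ (+-mono-≤ bound₃ bound₄)) ⟩
  4 * D ^ 0 * x ^ 3 * m ^ 2 * M + (8 * D ^ 1 * x ^ 3 * m ^ 2 * M +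
    (16 * D ^ 2 * x ^ 3 * m ^ 2 * M + 64 * D ^ 3 * x ^ 3 * m ^ 2 * M))
    ≡⟨ collect D r m M ⟩
  constant κ * (r ^ 6 * m ^ 2) * M ∎
  where
  open ≤-Reasoning
  M = length (𝓗 n r m)
  x = 2 * (r * r)
  D = 2 * ((2 * κ) * (2 * κ))
  S₁ = count (hasChain? r (3 ∷ [])) (𝓗 n r m)
  S₂ = count (hasChain? r (2 ∷ 2 ∷ [])) (𝓗 n r m)
  S₃ = count (hasChain? r (2 ∷ 1 ∷ 2 ∷ [])) (𝓗 n r m)
  S₄ = count (hasChain? r (2 ∷ 0 ∷ 2 ∷ 0 ∷ 2 ∷ [])) (𝓗 n r m)
  instance _ = >-nonZero (≤-trans (s≤s z≤n) n≥12)
  n≤N = n≤nCr {n} {r} {m} {κ} growth r≥3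

  xm²≤Dn : x * m ^ 2 ≤ D * n
  xm²≤Dn = r²m²≤n {n} {r} {m} {κ} growth
  open Rescale {x} {m} {n} {D} m≥1 xm²≤Dn

  bound₁ : S₁ * n ^ 3 ≤ 4 * D ^ 0 * x ^ 3 * m ^ 2 * M
  bound₁ = rescale {S₁} {4} {M} 0 0 z≤n (count-short-chain-bound n r m n≥12 n≤N (3 ∷ []))
  bound₂ : S₂ * n ^ 3 ≤ 8 * D ^ 1 * x ^ 3 * m ^ 2 * M
  bound₂ = rescale {S₂} {8} {M} 1 1 (s≤s z≤n) (count-short-chain-bound n r m n≥12 n≤N (2 ∷ 2 ∷ []))
  bound₃ : S₃ * n ^ 3 ≤ 16 * D ^ 2 * x ^ 3 * m ^ 2 * M
  bound₃ = rescale {S₃} {16} {M} 2 2 (s≤s (s≤s z≤n)) (count-short-chain-bound n r m n≥12 n≤N (2 ∷ 1 ∷ 2 ∷ []))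
  bound₄ : S₄ * n ^ 3 ≤ 64 * D ^ 3 * x ^ 3 * m ^ 2 * M
  bound₄ = rescale {S₄} {64} {M} 3 4 (s≤s (s≤s (s≤s (s≤s z≤n)))) (count-short-chain-bound n r m n≥12 n≤N (2 ∷ 0 ∷ 2 ∷ 0 ∷ 2 ∷ []))

  distrib : ∀ a b c d x → (a + (b + (c + d))) * x ≡ a * x + (b * x + (c * x + d * x))
  distrib = solve-∀
  collect : ∀ d a b c → let x = 2 * (a * a) in
    4 * 1 * (x * (x * (x * 1))) * (b * (b * 1)) * c +
    (8 * (d * 1) * (x * (x * (x * 1))) * (b * (b * 1)) * c +
    (16 * (d * (d * 1)) * (x * (x * (x * 1))) * (b * (b * 1)) * c +
    64 * (d * (d * (d * 1))) * (x * (x * (x * 1))) * (b * (b * 1)) * c))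
    ≡ 8 * (4 + 8 * d + 16 * (d * (d * 1)) + 64 * (d * (d * (d * 1))))
        * ((a * (a * (a * (a * (a * (a * 1)))))) * (b * (b * 1))) * c
  collect = solve-∀

theorem8p1 : (dec : ∀ {n} → Decidable (Plus {n})) →
    (r m : ℕ → ℕ) → (∀ n → 3 ≤ r n) → (∀ n → 1 ≤ m n) →
    -- m = O(log (n / r²)), in the equivalent exponentiated form e^m ≤ (n/r²)^K
    Σ ℕ (λ K → Σ ℕ (λ N₀ → ∀ n → N₀ ≤ n → 2 ^ m n * r n ^ (2 * K) ≤ n ^ K)) →
    Σ ℕ (λ C → Σ ℕ (λ N → ∀ n → N ≤ n →
      (length (𝓗 n (r n) (m n)) ∸ countPlus dec n (r n) (m n)) * n ^ 3
        ≤ C * (r n ^ 6 * m n ^ 2) * length (𝓗 n (r n) (m n))))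
theorem8p1 dec r m r≥3 m≥1 (zero , N₀ , growth) =
  ⊥-elim (<⇒≱ (^-monoʳ-≤ 2 (m≥1 N₀)) (≤-trans (≤-reflexive (sym (*-identityʳ _))) (growth N₀ ≤-refl)))
theorem8p1 dec r m r≥3 m≥1 (κ@(suc _) , N₀ , growth) = constant κ , N₀ + 12 , λ n N₀+12≤n →
  main-bound dec n (r n) (m n) κ (r≥3 n) (m≥1 n) (≤-trans (m≤n+m 12 N₀) N₀+12≤n)
    (growth n (≤-trans (m≤m+n N₀ 12) N₀+12≤n))
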